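{- Let $\Phi$ be an $\mathcal{ALCQIO}_{b,Re}$-formula with reachability assertions $Reach(B_{h'},S_{h'},A_{h'})$, $1\le h'\le h$, let $\mathcal M$ be a $\Phi$-semi-connected structure, fix $h'$, let $f$ be an $h'$-useful labeling for $\mathcal M$, and let $X$ be a base for $D_{h'}^{\mathcal M}$ with $\mathit{val}_f(X)=\mathit{val}_f(D_{h'}^{\mathcal M})$. Then every $x\in X$ either belongs to $B_{h'}^{\mathcal M}$ or lies on a directed cycle of $D_{h'}^{\mathcal M}$.
   Context: Setting: $\Phi=\varphi\land\bigwedge RE\land\bigwedge DI$ with $\varphi$ a Boolean combination of concept inclusions in description logic $\mathcal{ALCQIO}_b$ (concepts from atomic concepts and nominals via $\sqcap,\sqcup,\neg,\exists r.C,\exists^{\le n}r.C$, $r$ an atomic role or inverse), $RE$ a finite set of assertions $Reach(B,S,A)$ ($A,B$ atomic concepts, $S$ a set of functional roles), $DI$ a set of concept disjointness statements $A_1\sqcap A_2\equiv\bot$. Structures are finite. $assoc(\Phi)=\varphi\land\bigwedge_{h'}(B_{h'}\sqsubseteq A_{h'})\land\bigwedge DI$. $D^{\mathcal M}_{h'}$ is the directed graph with vertex set $A_{h'}^{\mathcal M}$ and edges $\left(\bigcup_{s\in S_{h'}}s^{\mathcal M}\right)\cap(A_{h'}^{\mathcal M})^2$. $\mathcal M$ is $\Phi$-semi-connected if $\mathcal M\models assoc(\Phi)$ and for every $h'$ and every $u\in A_{h'}^{\mathcal M}$, $u$ is reachable in $D_{h'}^{\mathcal M}$ from a vertex of $B_{h'}^{\mathcal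 M}$ or from a vertex on a directed cycle of $D_{h'}^{\mathcal M}$. $C\in\varphi$ means $C$ is a concept occurring as a side of an inclusion in $\varphi$; $\mathrm{TYPES}_\varphi$ is the power set of $\{C:C\in\varphi\}$; the type of $u$ is the set of $C\in\varphi$ containing $u$. A function $f:A_{h'}^{\mathcal M}\to\{1,\dots,|\mathrm{TYPES}_\varphi|\}$ is an $h'$-useful labeling if (1) equal labels imply equal types and (2) every $u\in A_{h'}^{\mathcal M}\setminus B_{h'}^{\mathcal M}$ admits $v,w\in A_{h'}^{\mathcal M}$ with $f(u)=f(v)$, $f(w)<f(v)$ and $(w,v)$ an edge of $D_{h'}^{\mathcal M}$. A set $X\subseteq A_{h'}^{\mathcal M}$ is a base for $D_{h'}^{\mathcal M}$ if every vertex is reachable from some element of $X$; $\mathit{val}_f(X)=\sum_{x\in X\setminus B_{h'}^{\mathcal M}}f(x)$ and $\mathit{val}_f(D_{h'}^{\mathcal M})$ is the minimum of $\mathit{val}_f(X)$ over bases $X$. -}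

module Defs where

open import Data.Nat as ℕ using (ℕ; zero; suc; _+_; _≤_; _<_; _^_; _≤ᵇ_)
open import Data.Bool using (Bool; true; false; _∧_; _∨_; not; if_then_else_)
open import Data.Fin as Fin using (Fin)
open import Data.List using (List; []; _∷_; _++_; length; allFin; deduplicate; filter; map; lookup)
open import Data.Bool.ListAction using (any; all)
open import Data.Nat.ListAction using (sum)
open import Data.List.Membership.Propositional using (_∈_)
open import Data.Product using (Σ; _×_; _,_; ∃; ∃-syntax)
open import Data.Sum using (_⊎_)
open import Relation.Nullary using (Dec; yes; no; ¬_)
open import Relation.Nullary.Decidable using (⌊_⌋)
open import Relation.Binary.PropositionalEquality using (_≡_; refl; cong; cong₂)
open import Relation.Binary.Construct.Closure.ReflexiveTransitive using (Star)
open import Relation.Binary.Construct.Closure.Transitive using (TransClosure)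

data Role : Set where
  rAtom : ℕ → Role
  rInv  : ℕ → Role

data Concept : Set where
  cAtom   : ℕ → Concept
  cNom    : ℕ → Concept
  cAnd    : Concept → Concept → Concept
  cOr     : Concept → Concept → Concept
  cNot    : Concept → Concept
  cEx     : Role → Concept → Concept
  cAtMost : ℕ → Role → Concept → Concept

data Formula : Set where
  fIncl : Concept → Concept → Formula
  fNot  : Formula → Formula
  fAnd  : Formula → Formula → Formula
  fOr   : Formula → Formula → Formula

-- Reach(B, S, A): B, A atomic concept names, S a set (list) of functional atomic roles
record ReachAssertion : Set where
  field
    B : ℕ
    S : List ℕ
    A : ℕ

-- DI-statement A₁ ⊓ A₂ ≡ ⊥ as a pair (A₁ , A₂)
record PhiFormula : Set where
  field
    φ  : Formula
    RE : List ReachAssertion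
    DI : List (ℕ × ℕ)

-- Decidable syntactic equality (needed to form the *set* {C : C ∈ φ})

private
  dec1 : ∀ {A B : Set} {x y : A} {f : A → B} →
         (x ≡ y → f x ≡ f y) → (f x ≡ f y → x ≡ y) → Dec (x ≡ y) → Dec (f x ≡ f y)
  dec1 i j (yes p) = yes (i p)
  dec1 i j (no ¬p) = no (λ q → ¬p (j q))

  dec2 : ∀ {A B C : Set} {x y : A} {u v : B} {fx fy : C} →
         (x ≡ y → u ≡ v → fx ≡ fy) → (fx ≡ fy → x ≡ y) → (fx ≡ fy → u ≡ v) →
         Dec (x ≡ y) → Dec (u ≡ v) → Dec (fx ≡ fy)
  dec2 i j k (yes p) (yes q) = yes (i p q)
  dec2 i j k (no ¬p) _ = no (λ e → ¬p (j e))
  dec2 i j k (yes _) (no ¬q) = no (λ e → ¬q (k e))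

  dec3 : ∀ {A B C D : Set} {x y : A} {u v : B} {s t : C} {fx fy : D} →
         (x ≡ y → u ≡ v → s ≡ t → fx ≡ fy) →
         (fx ≡ fy → x ≡ y) → (fx ≡ fy → u ≡ v) → (fx ≡ fy → s ≡ t) →
         Dec (x ≡ y) → Dec (u ≡ v) → Dec (s ≡ t) → Dec (fx ≡ fy)
  dec3 i j k l (yes p) (yes q) (yes r) = yes (i p q r)
  dec3 i j k l (no ¬p) _ _ = no (λ e → ¬p (j e))
  dec3 i j k l (yes _) (no ¬q) _ = no (λ e → ¬q (k e))
  dec3 i j k l (yes _) (yes _) (no ¬r) = no (λ e → ¬r (l e))

_≟R_ : (r s : Role) → Dec (r ≡ s)
rAtom a ≟R rAtom b = dec1 (cong rAtom) (λ {refl → refl}) (a ℕ.≟ b)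
rAtom a ≟R rInv b = no (λ ())
rInv a ≟R rAtom b = no (λ ())
rInv a ≟R rInv b = dec1 (cong rInv) (λ {refl → refl}) (a ℕ.≟ b)

_≟C_ : (C D : Concept) → Dec (C ≡ D)
(cAtom a) ≟C (cAtom a') = dec1 (cong cAtom) (λ {refl → refl}) (a ℕ.≟ a')
(cAtom a) ≟C (cNom a') = no (λ ())
(cAtom a) ≟C (cAnd C' D') = no (λ ())
(cAtom a) ≟C (cOr C' D') = no (λ ())
(cAtom a) ≟C (cNot C') = no (λ ())
(cAtom a) ≟C (cEx r' C') = no (λ ())
(cAtom a) ≟C (cAtMost k' r' C') = no (λ ())
(cNom a) ≟C (cAtom a') = no (λ ())
(cNom a) ≟C (cNom a') = dec1 (cong cNom) (λ {refl → refl}) (a ℕ.≟ a')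
(cNom a) ≟C (cAnd C' D') = no (λ ())
(cNom a) ≟C (cOr C' D') = no (λ ())
(cNom a) ≟C (cNot C') = no (λ ())
(cNom a) ≟C (cEx r' C') = no (λ ())
(cNom a) ≟C (cAtMost k' r' C') = no (λ ())
(cAnd C D) ≟C (cAtom a') = no (λ ())
(cAnd C D) ≟C (cNom a') = no (λ ())
(cAnd C D) ≟C (cAnd C' D') = dec2 (cong₂ cAnd) (λ {refl → refl}) (λ {refl → refl}) (C ≟C C') (D ≟C D')
(cAnd C D) ≟C (cOr C' D') = no (λ ())
(cAnd C D) ≟C (cNot C') = no (λ ())
(cAnd C D) ≟C (cEx r' C') = no (λ ())
(cAnd C D) ≟C (cAtMost k' r' C') = no (λ ())
(cOr C D) ≟C (cAtom a') = no (λ ())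
(cOr C D) ≟C (cNom a') = no (λ ())
(cOr C D) ≟C (cAnd C' D') = no (λ ())
(cOr C D) ≟C (cOr C' D') = dec2 (cong₂ cOr) (λ {refl → refl}) (λ {refl → refl}) (C ≟C C') (D ≟C D')
(cOr C D) ≟C (cNot C') = no (λ ())
(cOr C D) ≟C (cEx r' C') = no (λ ())
(cOr C D) ≟C (cAtMost k' r' C') = no (λ ())
(cNot C) ≟C (cAtom a') = no (λ ())
(cNot C) ≟C (cNom a') = no (λ ())
(cNot C) ≟C (cAnd C' D') = no (λ ())
(cNot C) ≟C (cOr C' D') = no (λ ())
(cNot C) ≟C (cNot C') = dec1 (cong cNot) (λ {refl → refl}) (C ≟C C')
(cNot C) ≟C (cEx r' C') = no (λ ())
(cNot C) ≟C (cAtMost k' r' C') = no (λ ())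
(cEx r C) ≟C (cAtom a') = no (λ ())
(cEx r C) ≟C (cNom a') = no (λ ())
(cEx r C) ≟C (cAnd C' D') = no (λ ())
(cEx r C) ≟C (cOr C' D') = no (λ ())
(cEx r C) ≟C (cNot C') = no (λ ())
(cEx r C) ≟C (cEx r' C') = dec2 (cong₂ cEx) (λ {refl → refl}) (λ {refl → refl}) (r ≟R r') (C ≟C C')
(cEx r C) ≟C (cAtMost k' r' C') = no (λ ())
(cAtMost k r C) ≟C (cAtom a') = no (λ ())
(cAtMost k r C) ≟C (cNom a') = no (λ ())
(cAtMost k r C) ≟C (cAnd C' D') = no (λ ())
(cAtMost k r C) ≟C (cOr C' D') = no (λ ())
(cAtMost k r C) ≟C (cNot C') = no (λ ())
(cAtMost k r C) ≟C (cEx r' C') = no (λ ())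
(cAtMost k r C) ≟C (cAtMost k' r' C') = dec3 (λ {refl refl refl → refl}) (λ {refl → refl}) (λ {refl → refl}) (λ {refl → refl}) (k ℕ.≟ k') (r ≟R r') (C ≟C C')

sidesList : Formula → List Concept
sidesList (fIncl C D) = C ∷ D ∷ []
sidesList (fNot f)    = sidesList f
sidesList (fAnd f g)  = sidesList f ++ sidesList g
sidesList (fOr f g)   = sidesList f ++ sidesList g

sides : Formula → List Concept
sides f = deduplicate _≟C_ (sidesList f)

-- |TYPES_φ| = |power set of {C : C ∈ φ}|
numTypes : Formula → ℕ
numTypes f = 2 ^ length (sides f)

-- Finite structures (domain Fin n; nominals force n ≥ 1)

record Structure : Set where
  field
    n    : ℕ
    conc : ℕ → Fin n → Bool
    nom  : ℕ → Fin n
    role : ℕ → Fin n → Fin n → Bool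

module _ (M : Structure) where
  open Structure M

  roleSem : Role → Fin n → Fin n → Bool
  roleSem (rAtom r) u v = role r u v
  roleSem (rInv r)  u v = role r v u

  countTrue : List Bool → ℕ
  countTrue [] = 0
  countTrue (true ∷ bs) = suc (countTrue bs)
  countTrue (false ∷ bs) = countTrue bs

  ⟦_⟧ : Concept → Fin n → Bool
  ⟦ cAtom a ⟧ u = conc a u
  ⟦ cNom o ⟧ u = ⌊ nom o Fin.≟ u ⌋
  ⟦ cAnd C D ⟧ u = ⟦ C ⟧ u ∧ ⟦ D ⟧ u
  ⟦ cOr C D ⟧ u = ⟦ C ⟧ u ∨ ⟦ D ⟧ u
  ⟦ cNot C ⟧ u = not (⟦ C ⟧ u)
  ⟦ cEx r C ⟧ u = any (λ v → roleSem r u v ∧ ⟦ C ⟧ v) (allFin n)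
  ⟦ cAtMost k r C ⟧ u =
    countTrue (map (λ v → roleSem r u v ∧ ⟦ C ⟧ v) (allFin n)) ≤ᵇ k

  ⟦_⟧F : Formula → Bool
  ⟦ fIncl C D ⟧F = all (λ u → not (⟦ C ⟧ u) ∨ ⟦ D ⟧ u) (allFin n)
  ⟦ fNot f ⟧F = not ⟦ f ⟧F
  ⟦ fAnd f g ⟧F = ⟦ f ⟧F ∧ ⟦ g ⟧F
  ⟦ fOr f g ⟧F = ⟦ f ⟧F ∨ ⟦ g ⟧F

  InC : ℕ → Fin n → Set
  InC a u = conc a u ≡ true

  ModelsAssoc : PhiFormula → Set
  ModelsAssoc Φ =
    (⟦ PhiFormula.φ Φ ⟧F ≡ true)
    × (∀ ra → ra ∈ PhiFormula.RE Φ → ∀ u →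
         InC (ReachAssertion.B ra) u → InC (ReachAssertion.A ra) u)
    × (∀ d → d ∈ PhiFormula.DI Φ → ∀ u →
         ¬ (InC (Data.Product.proj₁ d) u × InC (Data.Product.proj₂ d) u))

  FunctionalRoles : List ℕ → Set
  FunctionalRoles S = ∀ s → s ∈ S → ∀ u v w →
    role s u v ≡ true → role s u w ≡ true → v ≡ w

  module _ (ra : ReachAssertion) where
    open ReachAssertion ra

    Edge : Fin n → Fin n → Set
    Edge u v = InC A u × InC A v × (∃[ s ] (s ∈ S × role s u v ≡ true))

    Reachable : Fin n → Fin n → Set
    Reachable = Star Edge

    OnCycle : Fin n → Set
    OnCycle u = TransClosure Edge u u

  SemiConnected : PhiFormula → Set
  SemiConnected Φ =
    ModelsAssoc Φ ×
    (∀ ra → ra ∈ PhiFormula.RE Φ → ∀ u → InC (ReachAssertion.A ra) u →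
       ∃[ y ] ((InC (ReachAssertion.B ra) y ⊎ OnCycle ra y) × Reachable ra y u))

  SameType : Formula → Fin n → Fin n → Set
  SameType f u v = ∀ C → C ∈ sides f → ⟦ C ⟧ u ≡ ⟦ C ⟧ v

  -- f : A^M → {1,…,|TYPES_φ|} is an h'-useful labeling
  -- (f is given as a total function on the domain; only its values on A^M matter)
  UsefulLabeling : Formula → ReachAssertion → (Fin n → ℕ) → Set
  UsefulLabeling φ ra f =
    (∀ u → InC A u → 1 ≤ f u × f u ≤ numTypes φ)
    × (∀ u v → InC A u → InC A v → f u ≡ f v → SameType φ u v)
    × (∀ u → InC A u → ¬ InC B u →
         ∃[ v ] ∃[ w ] (InC A v × InC A w × f u ≡ f v × f w < f v × Edge ra w v))
    where open ReachAssertion ra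

  IsBase : ReachAssertion → (Fin n → Bool) → Set
  IsBase ra X =
    (∀ x → X x ≡ true → InC (ReachAssertion.A ra) x)
    × (∀ u → InC (ReachAssertion.A ra) u →
         ∃[ x ] (X x ≡ true × Reachable ra x u))

  val : ReachAssertion → (Fin n → ℕ) → (Fin n → Bool) → ℕ
  val ra f X = sum (map (λ x → if X x ∧ not (conc (ReachAssertion.B ra) x)
                                then f x else 0) (allFin n))

  IsMinimalBase : ReachAssertion → (Fin n → ℕ) → (Fin n → Bool) → Set
  IsMinimalBase ra f X =
    IsBase ra X × (∀ Y → IsBase ra Y → val ra f X ≤ val ra f Y)

-- If x ∈ X \ B, then x has positive label, so X \ {x} has strictly smaller value and cannot be a base:
-- no other element of X reaches x. Semi-connectedness gives a root y (in B or on a cycle) with y →* x.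
-- Either y = x, and then x is not in B, so it is on a cycle; or y has an outgoing edge, hence lies in A
-- and is reached from some z ∈ X, which must be x itself, closing the cycle x →* y →⁺ x.
module Submission where

open import Defs
open import Data.Nat using (ℕ; _≤_; _<_; z≤n)
open import Data.Nat.Properties using (≤-refl; +-mono-≤; +-mono-<-≤; +-mono-≤-<; <-≤-trans; <-irrefl)
open import Data.Bool using (Bool; true; false; _∧_; not; if_then_else_)
open import Data.Bool.Properties using (not-¬)
open import Data.Fin as Fin using (Fin)
open import Data.List using ([]; _∷_; length; lookup; map; allFin)
open import Data.List.Relation.Unary.Any using (here; there)
open import Data.List.Membership.Propositional using (_∈_)
open import Data.List.Membership.Propositional.Properties using (∈-allFin; ∈-lookup)
open import Data.Nat.ListAction using (sum)
open import Data.Sum using (_⊎_; inj₁; inj₂)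
open import Data.Product using (_,_; _×_; proj₁; ∃-syntax)
open import Data.Empty using (⊥-elim)
open import Relation.Nullary using (yes; no)
open import Relation.Nullary.Decidable using (⌊_⌋)
open import Relation.Binary.PropositionalEquality using (_≡_; _≢_; refl)
open import Relation.Binary.Construct.Closure.ReflexiveTransitive using (Star; ε; _◅_; _◅◅_)
open import Relation.Binary.Construct.Closure.Transitive using (TransClosure; [_]; _∷_)

module _ {A : Set} {R : A → A → Set} where

  ◅⇒⁺ : ∀ {x y z} → R x y → Star R y z → TransClosure R x z
  ◅⇒⁺ e ε        = [ e ]
  ◅⇒⁺ e (e′ ◅ s) = e ∷ ◅⇒⁺ e′ s

  walk⇒⁺ : ∀ {x y z w} → Star R x y → R y z → Star R z w → TransClosure R x w
  walk⇒⁺ ε        e s = ◅⇒⁺ e s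
  walk⇒⁺ (e′ ◅ p) e s = ◅⇒⁺ e′ (p ◅◅ e ◅ s)

module _ {A : Set} (g h : A → ℕ) (g≤h : ∀ u → g u ≤ h u) where

  sum-map-mono-≤ : ∀ l → sum (map g l) ≤ sum (map h l)
  sum-map-mono-≤ []      = z≤n
  sum-map-mono-≤ (u ∷ l) = +-mono-≤ (g≤h u) (sum-map-mono-≤ l)

  sum-map-mono-< : ∀ {x l} → g x < h x → x ∈ l → sum (map g l) < sum (map h l)
  sum-map-mono-< {l = _ ∷ l} gx<hx (here refl) = +-mono-<-≤ gx<hx (sum-map-mono-≤ l)
  sum-map-mono-< {l = u ∷ _} gx<hx (there x∈l) = +-mono-≤-< (g≤h u) (sum-map-mono-< gx<hx x∈l)

module _ (M : Structure) (ra : ReachAssertion) where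
  open Structure M
  open ReachAssertion ra using (A; B)

  _without_ : (Fin n → Bool) → Fin n → Fin n → Bool
  (X without x) u = X u ∧ not ⌊ u Fin.≟ x ⌋

  without-keeps : ∀ X {x u} → X u ≡ true → u ≢ x → (X without x) u ≡ true
  without-keeps X {x} {u} Xu u≢x with u Fin.≟ x
  ... | yes u≡x = ⊥-elim (u≢x u≡x)
  ... | no _ rewrite Xu = refl

  without-⊆ : ∀ X {x u} → (X without x) u ≡ true → X u ≡ true
  without-⊆ X {u = u} Xu with X u
  ... | true = refl

  without-isBase : ∀ {X x z} → IsBase M ra X → X z ≡ true → z ≢ x → Reachable M ra z x →
                   IsBase M ra (X without x)
  without-isBase {X} {x} {z} (X⊆A , covers) Xz z≢x z→x =
    (λ u Xu → X⊆A u (without-⊆ X Xu)) , covers′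
    where
    covers′ : ∀ u → InC M A u → ∃[ y ] ((X without x) y ≡ true × Reachable M ra y u)
    covers′ u uA with covers u uA
    ... | y , Xy , y→u with y Fin.≟ x
    ...   | yes refl = z , without-keeps X Xz z≢x , z→x ◅◅ y→u
    ...   | no y≢x   = y , without-keeps X Xy y≢x , y→u

  val-without-< : ∀ f X {x} → X x ≡ true → conc B x ≡ false → 1 ≤ f x →
                  val M ra f (X without x) < val M ra f X
  val-without-< f X {x} Xx x∉B 1≤fx =
    sum-map-mono-< (term (X without x)) (term X) term-≤ term-< (∈-allFin x)
    where
    term : (Fin n → Bool) → Fin n → ℕ
    term Y u = if Y u ∧ not (conc B u) then f u else 0

    term-≤ : ∀ u → term (X without x) u ≤ term X u
    term-≤ u with X u | u Fin.≟ x | conc B u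
    ... | true  | yes _ | true  = ≤-refl
    ... | true  | yes _ | false = z≤n
    ... | true  | no _  | _     = ≤-refl
    ... | false | _     | _     = ≤-refl

    term-< : term (X without x) x < term X x
    term-< with x Fin.≟ x
    ... | no x≢x = ⊥-elim (x≢x refl)
    ... | yes _ rewrite Xx | x∉B = 1≤fx

  minimalBase-unreachable : ∀ {f X x z} → IsMinimalBase M ra f X → X x ≡ true → conc B x ≡ false →
                            1 ≤ f x → X z ≡ true → Reachable M ra z x → z ≡ x
  minimalBase-unreachable {f} {X} {x} {z} (isBase , minimal) Xx x∉B 1≤fx Xz z→x with z Fin.≟ x
  ... | yes z≡x = z≡x
  ... | no z≢x  = ⊥-elim (<-irrefl refl
        (<-≤-trans (val-without-< f X Xx x∉B 1≤fx) (minimal _ (without-isBase isBase Xz z≢x z→x))))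

  minimalBase-onCycle : ∀ {f X x} → IsMinimalBase M ra f X → X x ≡ true → conc B x ≡ false → 1 ≤ f x →
                        ∃[ y ] ((InC M B y ⊎ OnCycle M ra y) × Reachable M ra y x) → OnCycle M ra x
  minimalBase-onCycle _ _ x∉B _ (_ , inj₁ x∈B , ε) = ⊥-elim (not-¬ x∉B x∈B)
  minimalBase-onCycle _ _ _ _ (_ , inj₂ cycle , ε) = cycle
  minimalBase-onCycle min@((_ , covers) , _) Xx x∉B 1≤fx (y , _ , y→y₁ ◅ y₁→x)
    with covers y (proj₁ y→y₁)
  ... | z , Xz , z→y with minimalBase-unreachable min Xx x∉B 1≤fx Xz (z→y ◅◅ y→y₁ ◅ y₁→x)
  ...   | refl = walk⇒⁺ z→y y→y₁ y₁→x

lemma6 : (Φ : PhiFormula) (M : Structure)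
    → (∀ ra → ra ∈ PhiFormula.RE Φ → FunctionalRoles M (ReachAssertion.S ra))
    → SemiConnected M Φ
    → (h' : Fin (length (PhiFormula.RE Φ)))
    → (f : Fin (Structure.n M) → ℕ)
    → UsefulLabeling M (PhiFormula.φ Φ) (lookup (PhiFormula.RE Φ) h') f
    → (X : Fin (Structure.n M) → Bool)
    → IsMinimalBase M (lookup (PhiFormula.RE Φ) h') f X
    → ∀ x → X x ≡ true
    → InC M (ReachAssertion.B (lookup (PhiFormula.RE Φ) h')) x
    ⊎ OnCycle M (lookup (PhiFormula.RE Φ) h') x
lemma6 Φ M _ (_ , rooted) h' f (labelRange , _) X min@((X⊆A , _) , _) x Xx
  with Structure.conc M (ReachAssertion.B (lookup (PhiFormula.RE Φ) h')) x in x∈B?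
... | true  = inj₁ refl
... | false = inj₂ (minimalBase-onCycle M ra min Xx x∈B? (proj₁ (labelRange x xA)) (rooted ra (∈-lookup h') x xA))
  where
  ra : ReachAssertion
  ra = lookup (PhiFormula.RE Φ) h'
  xA : InC M (ReachAssertion.A ra) x
  xA = X⊆A x Xx
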